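{- Let $\mathcal{A}$ be a complementary alphabet and $P$ a word of length $2n$ in $\mathcal{A}$ having at least one $P$-valid plane tree, and let $T_0=T_0(P)$ be the $P$-valid plane tree produced by the greedy algorithm. If $T$ is a $P$-valid plane tree with $T\neq T_0$, then $T$ admits a valid local move of type 2.
   Context: A complementary alphabet $\mathcal{A}$ is a finite set in which every letter $B$ has a unique complement $\overline{B}\in\mathcal{A}$, with $\overline{B}\neq B$ and $\overline{\overline{B}}=B$. A plane tree is a rooted tree in which the children of each vertex are linearly ordered. For a plane tree with $n$ edges, label the $2n$ half-edges $1,\dots,2n$ by starting on the left side of the leftmost edge at the root and walking counterclockwise; each edge is $e(i,j)$, $i<j$, with $i,j$ the labels of its sides. For $P=p_1\cdots p_{2n}$, a plane tree with $n$ edges is $P$-valid if $p_i,p_j$ are complements for every edge $e(i,j)$. Local moves, for $i<j<i'<j'$: type 1: if $e(i,j)$, $e(i',j')$ are edges sharing a vertex, replace them by $e(i,j')$, $e(j,i')$; type 2: if $e(i,j')$, $e(j,i')$ are edges sharing a vertex, replace them by $e(i,j)$, $e(i',j')$. A local move on a $P$-valid tree is valid if the result is $P$-valid. Greedy algorithm: process positions $i=1,\dots,2n$ in order; at $i$, let $j_i<i$ be the largest currently unmatched position; if $p_i,p_{j_i}$ are complements, match them (edge $e(j_i,i)$), otherwise leave $i$ unmatched. When a $P$-valid tree exists the output is a $P$-valid plane tree, denoted $T_0(P)$. -}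

module Defs where

open import Level using (0ℓ)
open import Data.Nat using (ℕ; zero; suc; _+_; _*_; _<_)
open import Data.Fin using (Fin)
open import Data.List using (List; []; _∷_; _++_; _∷ʳ_; length; map)
open import Data.List.Membership.Propositional using (_∈_)
open import Data.Product using (_×_; _,_; ∃; ∃-syntax; Σ-syntax)
open import Data.Sum using (_⊎_)
open import Data.Maybe using (Maybe; just; nothing)
open import Relation.Nullary using (¬_; yes; no)
open import Relation.Binary.PropositionalEquality using (_≡_; _≢_)
open import Relation.Binary.Definitions using (DecidableEquality)
open import Function.Bundles using (_↔_)

-- Complementary alphabet: a finite set with a fixed-point-free involution.
-- (Decidable equality is recorded as a field; it holds for any finite set.)

record ComplementaryAlphabet : Set₁ where
  field
    Carrier     : Set
    card        : ℕ
    finite      : Fin card ↔ Carrier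
    _≟_         : DecidableEquality Carrier
    comp        : Carrier → Carrier
    comp-invol  : ∀ b → comp (comp b) ≡ b
    comp-nofix  : ∀ b → comp b ≢ b

data PlaneTree : Set where
  node : List PlaneTree → PlaneTree

sizeF : List PlaneTree → ℕ
sizeF []               = 0
sizeF (node cs ∷ ts)   = suc (sizeF cs + sizeF ts)

size : PlaneTree → ℕ
size (node cs) = sizeF cs

-- Vertices are named by their path from the root (list of child indices).
Vertex : Set
Vertex = List ℕ

record Edge : Set where
  constructor mkEdge
  field
    left  : ℕ
    right : ℕ
    upper : Vertex
    lower : Vertex
open Edge public

-- Contour walk labelling: edgesF ts k v c lists the edges of the forest ts
-- hanging from vertex v, the first tree being child number c of v, with
-- next half-edge label k.  The edge to a child with subtree of size s gets
-- labels k (left side, going down) and k + 1 + 2 s (right side, going up).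
edgesF : List PlaneTree → ℕ → Vertex → ℕ → List Edge
edgesF []             k v c = []
edgesF (node cs ∷ ts) k v c =
  mkEdge k (k + 1 + 2 * sizeF cs) v (v ∷ʳ c)
    ∷ (edgesF cs (suc k) (v ∷ʳ c) 0 ++ edgesF ts (k + 2 + 2 * sizeF cs) v (suc c))

-- all edges of a plane tree; half-edges labelled 1..2n starting at the
-- left side of the leftmost root edge, walking counterclockwise
edges : PlaneTree → List Edge
edges (node cs) = edgesF cs 1 [] 0

IsEdge : PlaneTree → ℕ → ℕ → Set
IsEdge T i j = ∃[ e ] (e ∈ edges T × left e ≡ i × right e ≡ j)

EdgesShareVertex : PlaneTree → ℕ → ℕ → ℕ → ℕ → Set
EdgesShareVertex T i j i' j' =
  ∃[ e ] ∃[ f ] (e ∈ edges T × left e ≡ i × right e ≡ j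
               × f ∈ edges T × left f ≡ i' × right f ≡ j'
               × (upper e ≡ upper f ⊎ upper e ≡ lower f
                  ⊎ lower e ≡ upper f ⊎ lower e ≡ lower f))

module _ (𝒜 : ComplementaryAlphabet) where
  open ComplementaryAlphabet 𝒜

  -- letter at (1-based) position i
  letter : List Carrier → ℕ → Maybe Carrier
  letter []       _             = nothing
  letter (a ∷ as) zero          = nothing
  letter (a ∷ as) (suc zero)    = just a
  letter (a ∷ as) (suc (suc i)) = letter as (suc i)

  Compl : List Carrier → ℕ → ℕ → Set
  Compl P i j = ∃[ a ] ∃[ b ] (letter P i ≡ just a × letter P j ≡ just b × b ≡ comp a)

  Valid : List Carrier → PlaneTree → Set
  Valid P T = 2 * size T ≡ length P × (∀ i j → IsEdge T i j → Compl P i j)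

  -- Greedy algorithm.  The stack holds unmatched positions (with letters),
  -- largest on top.
  greedyGo : List Carrier → ℕ → List (ℕ × Carrier) → List (ℕ × ℕ)
  greedyGo []       i st             = []
  greedyGo (a ∷ as) i []             = greedyGo as (suc i) ((i , a) ∷ [])
  greedyGo (a ∷ as) i ((j , b) ∷ st) with a ≟ comp b
  ... | yes _ = (j , i) ∷ greedyGo as (suc i) st
  ... | no  _ = greedyGo as (suc i) ((i , a) ∷ (j , b) ∷ st)

  greedy : List Carrier → List (ℕ × ℕ)
  greedy P = greedyGo P 1 []

  IsGreedyTree : List Carrier → PlaneTree → Set
  IsGreedyTree P T = 2 * size T ≡ length P
                   × (∀ i j → (IsEdge T i j → (i , j) ∈ greedy P)
                            × ((i , j) ∈ greedy P → IsEdge T i j))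

  ReplaceResult : PlaneTree → ℕ → ℕ → ℕ → ℕ → PlaneTree → Set
  ReplaceResult T i j i' j' T' =
    size T' ≡ size T
    × (∀ a b → (IsEdge T' a b →
                  ((IsEdge T a b × (a , b) ≢ (i , j') × (a , b) ≢ (j , i'))
                   ⊎ (a , b) ≡ (i , j) ⊎ (a , b) ≡ (i' , j')))
             × (((IsEdge T a b × (a , b) ≢ (i , j') × (a , b) ≢ (j , i'))
                   ⊎ (a , b) ≡ (i , j) ⊎ (a , b) ≡ (i' , j')) → IsEdge T' a b))

  HasValidType2Move : List Carrier → PlaneTree → Set
  HasValidType2Move P T =
    ∃[ i ] ∃[ j ] ∃[ i' ] ∃[ j' ]
      (i < j × j < i' × i' < j'
       × EdgesShareVertex T i j' j i'
       × ∃[ T' ] (ReplaceResult T i j i' j' T' × Valid P T'))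

-- Follow the greedy algorithm along the contour walk of a P-valid tree T. As
-- long as its matches are the edges of T, when the walk goes down an edge
-- e(k , r) the top of the stack is the left label k₀ of the parent edge
-- e(k₀ , r₀). If p_k complements p_k₀, replacing e(k₀ , r₀), e(k , r) by
-- e(k₀ , k), e(r , r₀) is a valid type 2 move, since p_r = comp p_k = p_k₀.
-- Otherwise k is pushed, the subtree below e(k , r) is matched edge by edge,
-- and at r the top of the stack is k again, so e(k , r) is matched. Hence if T
-- admits no valid type 2 move the greedy output is the edge set of T, which
-- determines T, so T = T₀.

module Submission where

open import Defs
open import Data.Nat using (ℕ; suc; _+_; _*_; _<_; _≤_; s≤s)
open import Data.Nat.Properties hiding (_≟_)
open import Data.Nat.Tactic.RingSolver using (solve-∀)
open import Data.List using (List; []; _∷_; _++_; _∷ʳ_; length)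
open import Data.List.Properties using (++-assoc; ++-identityʳ)
open import Data.List.Membership.Propositional using (_∈_)
open import Data.List.Membership.Propositional.Properties using (∈-++⁺ˡ; ∈-++⁺ʳ; ∈-++⁻)
open import Data.List.Relation.Binary.Subset.Propositional using (_⊆_)
open import Data.List.Relation.Unary.Any using (here; there)
open import Data.Maybe using (just; nothing)
open import Data.Maybe.Properties using (just-injective)
open import Data.Product using (_×_; _,_; ∃-syntax; proj₁; proj₂)
open import Data.Product.Properties using (,-injectiveˡ; ,-injectiveʳ)
open import Data.Sum using (_⊎_; inj₁; inj₂)
open import Data.Empty using (⊥-elim)
open import Relation.Nullary using (¬_; yes; no)
open import Relation.Binary.PropositionalEquality
open import Function using (_∘′_)

m+n≡o⇒m≤o : ∀ {m o} n → m + n ≡ o → m ≤ o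
m+n≡o⇒m≤o {m} n refl = m≤m+n m n

1+k+2s≡k+1+2s : ∀ k s → suc k + 2 * s ≡ k + 1 + 2 * s
1+k+2s≡k+1+2s = solve-∀

1+[k+1+2s]≡k+2+2s : ∀ k s → suc (k + 1 + 2 * s) ≡ k + 2 + 2 * s
1+[k+1+2s]≡k+2+2s = solve-∀

2+k+2s≡k+2+2s : ∀ k s → suc (suc k + 2 * s) ≡ k + 2 + 2 * s
2+k+2s≡k+2+2s = solve-∀

k+2+2s+2t≡k+2[1+s+t] : ∀ k s t → k + 2 + 2 * s + 2 * t ≡ k + 2 * suc (s + t)
k+2+2s+2t≡k+2[1+s+t] = solve-∀

k<k+1+2s : ∀ k s → k < k + 1 + 2 * s
k<k+1+2s k s = m+n≡o⇒m≤o (2 * s) (1+k+2s≡k+1+2s k s)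

k<k+2+2s : ∀ k s → k < k + 2 + 2 * s
k<k+2+2s k s = <-trans (k<k+1+2s k s) (≤-reflexive (1+[k+1+2s]≡k+2+2s k s))

1+k+2s<k+2+2s : ∀ k s → suc k + 2 * s < k + 2 + 2 * s
1+k+2s<k+2+2s k s = ≤-reflexive (2+k+2s≡k+2+2s k s)

1+k+2s≤k+2[1+s+t] : ∀ k s t → suc k + 2 * s ≤ k + 2 * suc (s + t)
1+k+2s≤k+2[1+s+t] k s t = m+n≡o⇒m≤o (1 + 2 * t) (eq k s t)
  where eq : ∀ k s t → suc k + 2 * s + (1 + 2 * t) ≡ k + 2 * suc (s + t)
        eq = solve-∀

k+1+2s<k+2[1+s+t] : ∀ k s t → k + 1 + 2 * s < k + 2 * suc (s + t)
k+1+2s<k+2[1+s+t] k s t = m+n≡o⇒m≤o (2 * t)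
  (trans (cong (_+ 2 * t) (1+[k+1+2s]≡k+2+2s k s)) (k+2+2s+2t≡k+2[1+s+t] k s t))

-- The labels (left , right) of the edges of a forest whose first half-edge is
-- labelled k, in the order in which the greedy algorithm emits its matches.
spans : List PlaneTree → ℕ → List (ℕ × ℕ)
spans []             k = []
spans (node cs ∷ ts) k = spans cs (suc k) ++ (k , k + 1 + 2 * sizeF cs) ∷ spans ts (k + 2 + 2 * sizeF cs)

sizeF-++ : ∀ xs ys → sizeF (xs ++ ys) ≡ sizeF xs + sizeF ys
sizeF-++ []             ys = refl
sizeF-++ (node cs ∷ xs) ys = cong suc (begin
  sizeF cs + sizeF (xs ++ ys)      ≡⟨ cong (sizeF cs +_) (sizeF-++ xs ys) ⟩
  sizeF cs + (sizeF xs + sizeF ys) ≡⟨ +-assoc (sizeF cs) (sizeF xs) (sizeF ys) ⟨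
  sizeF cs + sizeF xs + sizeF ys   ∎)
  where open ≡-Reasoning

spans-++ : ∀ xs ys k → spans (xs ++ ys) k ≡ spans xs k ++ spans ys (k + 2 * sizeF xs)
spans-++ []             ys k = cong (spans ys) (sym (+-identityʳ k))
spans-++ (node cs ∷ xs) ys k = begin
  spans cs (suc k) ++ (k , r) ∷ spans (xs ++ ys) n
    ≡⟨ cong (λ z → spans cs (suc k) ++ (k , r) ∷ z) (spans-++ xs ys n) ⟩
  spans cs (suc k) ++ (k , r) ∷ (spans xs n ++ spans ys (n + 2 * sizeF xs))
    ≡⟨ ++-assoc (spans cs (suc k)) ((k , r) ∷ spans xs n) _ ⟨
  spans (node cs ∷ xs) k ++ spans ys (n + 2 * sizeF xs)
    ≡⟨ cong (λ z → spans (node cs ∷ xs) k ++ spans ys z) (k+2+2s+2t≡k+2[1+s+t] k (sizeF cs) (sizeF xs)) ⟩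
  spans (node cs ∷ xs) k ++ spans ys (k + 2 * sizeF (node cs ∷ xs)) ∎
  where
  open ≡-Reasoning
  r = k + 1 + 2 * sizeF cs
  n = k + 2 + 2 * sizeF cs

root-span-∈ : ∀ cs ts k → (k , k + 1 + 2 * sizeF cs) ∈ spans (node cs ∷ ts) k
root-span-∈ cs ts k = ∈-++⁺ʳ (spans cs (suc k)) (here refl)

spans-∷⁻ : ∀ cs ts k {x} → x ∈ spans (node cs ∷ ts) k →
  x ∈ spans cs (suc k) ⊎ x ≡ (k , k + 1 + 2 * sizeF cs) ⊎ x ∈ spans ts (k + 2 + 2 * sizeF cs)
spans-∷⁻ cs ts k x∈ with ∈-++⁻ (spans cs (suc k)) x∈
... | inj₁ x∈cs         = inj₁ x∈cs
... | inj₂ (here x≡)    = inj₂ (inj₁ x≡)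
... | inj₂ (there x∈ts) = inj₂ (inj₂ x∈ts)

Within : ℕ → ℕ → ℕ × ℕ → Set
Within k s x = k ≤ proj₁ x × proj₁ x < proj₂ x × proj₂ x < k + 2 * s

spans-within : ∀ ts k {x} → x ∈ spans ts k → Within k (sizeF ts) x
spans-within (node cs ∷ ts) k x∈ with spans-∷⁻ cs ts k x∈
... | inj₁ x∈cs with spans-within cs (suc k) x∈cs
...   | k<a , a<b , b<end = <⇒≤ k<a , a<b , <-≤-trans b<end (1+k+2s≤k+2[1+s+t] k (sizeF cs) (sizeF ts))
spans-within (node cs ∷ ts) k x∈ | inj₂ (inj₁ refl) =
  ≤-refl , k<k+1+2s k (sizeF cs) , k+1+2s<k+2[1+s+t] k (sizeF cs) (sizeF ts)
spans-within (node cs ∷ ts) k {x} x∈ | inj₂ (inj₂ x∈ts) with spans-within ts _ x∈ts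
... | next≤a , a<b , b<end =
  ≤-trans (<⇒≤ (k<k+2+2s k (sizeF cs))) next≤a , a<b ,
  subst (proj₂ x <_) (k+2+2s+2t≡k+2[1+s+t] k (sizeF cs) (sizeF ts)) b<end

∈-edgesF⇒∈-spans : ∀ ts k v c {e} → e ∈ edgesF ts k v c → (left e , right e) ∈ spans ts k
∈-edgesF⇒∈-spans (node cs ∷ ts) k v c (here refl) = root-span-∈ cs ts k
∈-edgesF⇒∈-spans (node cs ∷ ts) k v c (there e∈) with ∈-++⁻ (edgesF cs (suc k) (v ∷ʳ c) 0) e∈
... | inj₁ e∈cs = ∈-++⁺ˡ (∈-edgesF⇒∈-spans cs (suc k) (v ∷ʳ c) 0 e∈cs)
... | inj₂ e∈ts = ∈-++⁺ʳ (spans cs (suc k)) (there (∈-edgesF⇒∈-spans ts _ v (suc c) e∈ts))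

∈-spans⇒∈-edgesF : ∀ ts k v c {x} → x ∈ spans ts k → ∃[ e ] (e ∈ edgesF ts k v c × (left e , right e) ≡ x)
∈-spans⇒∈-edgesF (node cs ∷ ts) k v c x∈ with spans-∷⁻ cs ts k x∈
... | inj₁ x∈cs with ∈-spans⇒∈-edgesF cs (suc k) (v ∷ʳ c) 0 x∈cs
...   | e , e∈ , e≡ = e , there (∈-++⁺ˡ e∈) , e≡
∈-spans⇒∈-edgesF (node cs ∷ ts) k v c x∈ | inj₂ (inj₁ refl) = _ , here refl , refl
∈-spans⇒∈-edgesF (node cs ∷ ts) k v c x∈ | inj₂ (inj₂ x∈ts) with ∈-spans⇒∈-edgesF ts _ v (suc c) x∈ts
... | e , e∈ , e≡ = e , there (∈-++⁺ʳ (edgesF cs (suc k) (v ∷ʳ c) 0) e∈) , e≡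

isEdge⇒∈-spans : ∀ cs {a b} → IsEdge (node cs) a b → (a , b) ∈ spans cs 1
isEdge⇒∈-spans cs (e , e∈ , refl , refl) = ∈-edgesF⇒∈-spans cs 1 [] 0 e∈

∈-spans⇒isEdge : ∀ cs {a b} → (a , b) ∈ spans cs 1 → IsEdge (node cs) a b
∈-spans⇒isEdge cs ab∈ with ∈-spans⇒∈-edgesF cs 1 [] 0 ab∈
... | e , e∈ , e≡ = e , e∈ , ,-injectiveˡ e≡ , ,-injectiveʳ e≡

edgesF-middle : ∀ L ds R k w c → ∃[ f ] (f ∈ edgesF (L ++ node ds ∷ R) k w c
  × left f ≡ k + 2 * sizeF L × right f ≡ k + 2 * sizeF L + 1 + 2 * sizeF ds × upper f ≡ w)
edgesF-middle []             ds R k w c =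
  _ , here refl , sym (+-identityʳ k) , cong (λ z → z + 1 + 2 * sizeF ds) (sym (+-identityʳ k)) , refl
edgesF-middle (node cs ∷ L) ds R k w c with edgesF-middle L ds R (k + 2 + 2 * sizeF cs) w (suc c)
... | f , f∈ , f-left , f-right , f-upper =
  f , there (∈-++⁺ʳ (edgesF cs (suc k) (w ∷ʳ c) 0) f∈) , trans f-left shift ,
  trans f-right (cong (λ z → z + 1 + 2 * sizeF ds) shift) , f-upper
  where shift = k+2+2s+2t≡k+2[1+s+t] k (sizeF cs) (sizeF L)

ParentEdge : List PlaneTree → ℕ → Vertex → ℕ → ℕ → ℕ → ℕ → ℕ → Set
ParentEdge ts k v c i j i' j' = ∃[ e ] ∃[ f ] (e ∈ edgesF ts k v c × left e ≡ i × right e ≡ j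
  × f ∈ edgesF ts k v c × left f ≡ i' × right f ≡ j' × lower e ≡ upper f)

ParentEdge-children : ∀ cs ts k v c {i j i' j'} → ParentEdge cs (suc k) (v ∷ʳ c) 0 i j i' j' →
  ParentEdge (node cs ∷ ts) k v c i j i' j'
ParentEdge-children cs ts k v c (e , f , e∈ , e-left , e-right , f∈ , f-left , f-right , e-f) =
  e , f , there (∈-++⁺ˡ e∈) , e-left , e-right , there (∈-++⁺ˡ f∈) , f-left , f-right , e-f

ParentEdge-siblings : ∀ cs ts k v c {i j i' j'} → ParentEdge ts (k + 2 + 2 * sizeF cs) v (suc c) i j i' j' →
  ParentEdge (node cs ∷ ts) k v c i j i' j'
ParentEdge-siblings cs ts k v c (e , f , e∈ , e-left , e-right , f∈ , f-left , f-right , e-f) =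
  e , f , there (∈-++⁺ʳ cs-edges e∈) , e-left , e-right , there (∈-++⁺ʳ cs-edges f∈) , f-left , f-right , e-f
  where cs-edges = edgesF cs (suc k) (v ∷ʳ c) 0

root-span-size : ∀ k s cs ts → (k , k + 1 + 2 * s) ∈ spans (node cs ∷ ts) k → s ≡ sizeF cs
root-span-size k s cs ts root∈ with spans-∷⁻ cs ts k root∈
... | inj₁ x∈cs      = ⊥-elim (<-irrefl refl (proj₁ (spans-within cs (suc k) x∈cs)))
... | inj₂ (inj₁ x≡) = *-cancelˡ-≡ s (sizeF cs) 2 (+-cancelˡ-≡ (k + 1) _ _ (,-injectiveʳ x≡))
... | inj₂ (inj₂ x∈ts) =
  ⊥-elim (<-irrefl refl (<-≤-trans (k<k+2+2s k (sizeF cs)) (proj₁ (spans-within ts _ x∈ts))))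

⊆-children : ∀ k c₁ t₁ c₂ t₂ → sizeF c₁ ≡ sizeF c₂ →
  spans (node c₁ ∷ t₁) k ⊆ spans (node c₂ ∷ t₂) k → spans c₁ (suc k) ⊆ spans c₂ (suc k)
⊆-children k c₁ t₁ c₂ t₂ same sub {x} x∈
  with spans-within c₁ (suc k) x∈ | spans-∷⁻ c₂ t₂ k (sub (∈-++⁺ˡ x∈))
... | _ | inj₁ x∈c₂ = x∈c₂
... | k<a , _ | inj₂ (inj₁ refl) = ⊥-elim (<-irrefl refl k<a)
... | _ , a<b , b<end | inj₂ (inj₂ x∈t₂) = ⊥-elim (<-irrefl refl (<-trans a<b (<-trans b<end₂ end₂<a)))
  where
  b<end₂ = subst (λ s → proj₂ x < suc k + 2 * s) same b<end
  end₂<a = <-≤-trans (1+k+2s<k+2+2s k (sizeF c₂)) (proj₁ (spans-within t₂ _ x∈t₂))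

⊆-siblings : ∀ k c t₁ t₂ → spans (node c ∷ t₁) k ⊆ spans (node c ∷ t₂) k →
  spans t₁ (k + 2 + 2 * sizeF c) ⊆ spans t₂ (k + 2 + 2 * sizeF c)
⊆-siblings k c t₁ t₂ sub x∈
  with spans-within t₁ _ x∈ | spans-∷⁻ c t₂ k (sub (∈-++⁺ʳ (spans c (suc k)) (there x∈)))
... | _ | inj₂ (inj₂ x∈t₂) = x∈t₂
... | next≤a , _ | inj₂ (inj₁ refl) = ⊥-elim (<-irrefl refl (<-≤-trans (k<k+2+2s k (sizeF c)) next≤a))
... | next≤a , _ | inj₁ x∈c with spans-within c (suc k) x∈c
...   | _ , a<b , b<end =
  ⊥-elim (<-irrefl refl (<-≤-trans (<-trans a<b (<-trans b<end (1+k+2s<k+2+2s k (sizeF c)))) next≤a))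

spans-injective : ∀ xs ys k → spans xs k ⊆ spans ys k → spans ys k ⊆ spans xs k → xs ≡ ys
spans-injective []             []             k _ _ = refl
spans-injective []             (node cs ∷ ys) k _ sub with sub (root-span-∈ cs ys k)
... | ()
spans-injective (node cs ∷ xs) []             k sub _ with sub (root-span-∈ cs xs k)
... | ()
spans-injective (node c₁ ∷ t₁) (node c₂ ∷ t₂) k sub₁ sub₂
  with root-span-size k (sizeF c₁) c₂ t₂ (sub₁ (root-span-∈ c₁ t₁ k))
... | same with spans-injective c₁ c₂ (suc k) (⊆-children k c₁ t₁ c₂ t₂ same sub₁) (⊆-children k c₂ t₂ c₁ t₁ (sym same) sub₂)
...   | refl = cong (node c₁ ∷_) (spans-injective t₁ t₂ _ (⊆-siblings k c₁ t₁ t₂ sub₁) (⊆-siblings k c₁ t₂ t₁ sub₂))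

module Replacement (i j i' j' : ℕ) where

  Kept : List (ℕ × ℕ) → ℕ × ℕ → Set
  Kept A x = x ∈ A × x ≢ (i , j') × x ≢ (j , i')

  Result : List (ℕ × ℕ) → ℕ × ℕ → Set
  Result A x = Kept A x ⊎ x ≡ (i , j) ⊎ x ≡ (i' , j')

  Replaces : List (ℕ × ℕ) → List (ℕ × ℕ) → Set
  Replaces A A' = ∀ x → (x ∈ A' → Result A x) × (Result A x → x ∈ A')

  Avoids : List (ℕ × ℕ) → Set
  Avoids X = ∀ {x} → x ∈ X → proj₁ x ≢ i × proj₁ x ≢ j

  kept : ∀ {X A x} → Avoids X → x ∈ X → x ∈ A → Kept A x
  kept avoids x∈X x∈A =
    x∈A , (λ x≡ → proj₁ (avoids x∈X) (cong proj₁ x≡)) , (λ x≡ → proj₂ (avoids x∈X) (cong proj₁ x≡))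

  Replaces-++ʳ : ∀ {A A' X} → Replaces A A' → Avoids X → Replaces (A ++ X) (A' ++ X)
  Replaces-++ʳ {A} {A'} {X} replaces avoids x = to , from
    where
    to : x ∈ A' ++ X → Result (A ++ X) x
    to x∈ with ∈-++⁻ A' x∈
    ... | inj₂ x∈X = inj₁ (kept avoids x∈X (∈-++⁺ʳ A x∈X))
    ... | inj₁ x∈A' with proj₁ (replaces x) x∈A'
    ...   | inj₁ (x∈A , x≢₁ , x≢₂) = inj₁ (∈-++⁺ˡ x∈A , x≢₁ , x≢₂)
    ...   | inj₂ new               = inj₂ new
    from : Result (A ++ X) x → x ∈ A' ++ X
    from (inj₂ new) = ∈-++⁺ˡ (proj₂ (replaces x) (inj₂ new))
    from (inj₁ (x∈ , x≢₁ , x≢₂)) with ∈-++⁻ A x∈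
    ... | inj₁ x∈A = ∈-++⁺ˡ (proj₂ (replaces x) (inj₁ (x∈A , x≢₁ , x≢₂)))
    ... | inj₂ x∈X = ∈-++⁺ʳ A' x∈X

  Replaces-++ˡ : ∀ {A A' X} → Replaces A A' → Avoids X → Replaces (X ++ A) (X ++ A')
  Replaces-++ˡ {A} {A'} {X} replaces avoids x = to , from
    where
    to : x ∈ X ++ A' → Result (X ++ A) x
    to x∈ with ∈-++⁻ X x∈
    ... | inj₁ x∈X = inj₁ (kept avoids x∈X (∈-++⁺ˡ x∈X))
    ... | inj₂ x∈A' with proj₁ (replaces x) x∈A'
    ...   | inj₁ (x∈A , x≢₁ , x≢₂) = inj₁ (∈-++⁺ʳ X x∈A , x≢₁ , x≢₂)
    ...   | inj₂ new               = inj₂ new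
    from : Result (X ++ A) x → x ∈ X ++ A'
    from (inj₂ new) = ∈-++⁺ʳ X (proj₂ (replaces x) (inj₂ new))
    from (inj₁ (x∈ , x≢₁ , x≢₂)) with ∈-++⁻ X x∈
    ... | inj₁ x∈X = ∈-++⁺ˡ x∈X
    ... | inj₂ x∈A = ∈-++⁺ʳ X (proj₂ (replaces x) (inj₁ (x∈A , x≢₁ , x≢₂)))

  rotation-replaces : ∀ {A B C D} → Avoids A → Avoids B → Avoids C → Avoids D →
    Replaces ((A ++ (B ++ (j , i') ∷ C)) ++ (i , j') ∷ D) (A ++ (i , j) ∷ (B ++ (C ++ (i' , j') ∷ D)))
  rotation-replaces {A} {B} {C} {D} avA avB avC avD x = to , from
    where
    Old = (A ++ (B ++ (j , i') ∷ C)) ++ (i , j') ∷ D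
    kept-in-Old : ∀ {Y} → Avoids Y → (x ∈ Y → x ∈ Old) → x ∈ Y → Result Old x
    kept-in-Old av embed x∈Y = inj₁ (kept av x∈Y (embed x∈Y))
    to : x ∈ A ++ (i , j) ∷ (B ++ (C ++ (i' , j') ∷ D)) → Result Old x
    to x∈ with ∈-++⁻ A x∈
    ... | inj₁ x∈A        = kept-in-Old avA (∈-++⁺ˡ ∘′ ∈-++⁺ˡ) x∈A
    ... | inj₂ (here x≡)  = inj₂ (inj₁ x≡)
    ... | inj₂ (there x∈′) with ∈-++⁻ B x∈′
    ...   | inj₁ x∈B = kept-in-Old avB (∈-++⁺ˡ ∘′ ∈-++⁺ʳ A ∘′ ∈-++⁺ˡ) x∈B
    ...   | inj₂ x∈″ with ∈-++⁻ C x∈″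
    ...     | inj₁ x∈C         = kept-in-Old avC (∈-++⁺ˡ ∘′ ∈-++⁺ʳ A ∘′ ∈-++⁺ʳ B ∘′ there) x∈C
    ...     | inj₂ (here x≡)   = inj₂ (inj₂ x≡)
    ...     | inj₂ (there x∈D) = kept-in-Old avD (∈-++⁺ʳ (A ++ (B ++ (j , i') ∷ C)) ∘′ there) x∈D
    from : Result Old x → x ∈ A ++ (i , j) ∷ (B ++ (C ++ (i' , j') ∷ D))
    from (inj₂ (inj₁ refl)) = ∈-++⁺ʳ A (here refl)
    from (inj₂ (inj₂ refl)) = ∈-++⁺ʳ A (there (∈-++⁺ʳ B (∈-++⁺ʳ C (here refl))))
    from (inj₁ (x∈ , x≢ij' , x≢ji')) with ∈-++⁻ (A ++ (B ++ (j , i') ∷ C)) x∈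
    ... | inj₂ (here x≡)   = ⊥-elim (x≢ij' x≡)
    ... | inj₂ (there x∈D) = ∈-++⁺ʳ A (there (∈-++⁺ʳ B (∈-++⁺ʳ C (there x∈D))))
    ... | inj₁ x∈′ with ∈-++⁻ A x∈′
    ...   | inj₁ x∈A = ∈-++⁺ˡ x∈A
    ...   | inj₂ x∈″ with ∈-++⁻ B x∈″
    ...     | inj₁ x∈B         = ∈-++⁺ʳ A (there (∈-++⁺ˡ x∈B))
    ...     | inj₂ (here x≡)   = ⊥-elim (x≢ji' x≡)
    ...     | inj₂ (there x∈C) = ∈-++⁺ʳ A (there (∈-++⁺ʳ B (∈-++⁺ˡ x∈C)))

open Replacement

-- The child edge e(m , m') of the root edge e(k , r) is rotated away: the
-- forest after carries e(k , m) over L and e(m' , r) over R, and the trees of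
-- ds become siblings between them.
module Rotation (L ds R ts : List PlaneTree) (k : ℕ) where

  cs : List PlaneTree
  cs = L ++ node ds ∷ R

  m m' r n : ℕ
  m  = suc k + 2 * sizeF L
  m' = m + 1 + 2 * sizeF ds
  r  = k + 1 + 2 * sizeF cs
  n  = k + 2 + 2 * sizeF cs

  before after : List PlaneTree
  before = node cs ∷ ts
  after  = node L ∷ (ds ++ node R ∷ ts)

  A B C D : List (ℕ × ℕ)
  A = spans L (suc k)
  B = spans ds (suc m)
  C = spans R (m + 2 + 2 * sizeF ds)
  D = spans ts n

  spans-cs : spans cs (suc k) ≡ A ++ (B ++ (m , m') ∷ C)
  spans-cs = spans-++ L (node ds ∷ R) (suc k)

  spans-before : spans before k ≡ (A ++ (B ++ (m , m') ∷ C)) ++ (k , r) ∷ D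
  spans-before = cong (_++ (k , r) ∷ D) spans-cs

  spans-after : spans after k ≡ A ++ (k , m) ∷ (B ++ (C ++ (m' , r) ∷ D))
  spans-after = begin
    spans after k
      ≡⟨ cong (λ z → A ++ (k , k + 1 + 2 * l) ∷ z) (spans-++ ds (node R ∷ ts) (k + 2 + 2 * l)) ⟩
    shape (k + 1 + 2 * l) (k + 2 + 2 * l) (suc p) p (p + 1 + 2 * sizeF R) (p + 2 + 2 * sizeF R)
      ≡⟨ shape-cong (sym (1+k+2s≡k+1+2s k l)) (sym (2+k+2s≡k+2+2s k l)) (e₃ k l d) (e₄ k l d)
                    (trans (e₅ k l d (sizeF R)) (cong (λ s → k + 1 + 2 * s) (sym size-cs)))
                    (trans (e₆ k l d (sizeF R)) (cong (λ s → k + 2 + 2 * s) (sym size-cs))) ⟩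
    shape m (suc m) (m + 2 + 2 * d) m' r n ∎
    where
    open ≡-Reasoning
    l = sizeF L
    d = sizeF ds
    p = k + 2 + 2 * l + 2 * d
    size-cs : sizeF cs ≡ l + suc (d + sizeF R)
    size-cs = sizeF-++ L (node ds ∷ R)
    shape : ℕ → ℕ → ℕ → ℕ → ℕ → ℕ → List (ℕ × ℕ)
    shape x₁ x₂ x₃ x₄ x₅ x₆ = A ++ (k , x₁) ∷ (spans ds x₂ ++ (spans R x₃ ++ (x₄ , x₅) ∷ spans ts x₆))
    shape-cong : ∀ {x₁ x₂ x₃ x₄ x₅ x₆ y₁ y₂ y₃ y₄ y₅ y₆} → x₁ ≡ y₁ → x₂ ≡ y₂ → x₃ ≡ y₃ →
      x₄ ≡ y₄ → x₅ ≡ y₅ → x₆ ≡ y₆ → shape x₁ x₂ x₃ x₄ x₅ x₆ ≡ shape y₁ y₂ y₃ y₄ y₅ y₆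
    shape-cong refl refl refl refl refl refl = refl
    e₃ : ∀ k l d → suc (k + 2 + 2 * l + 2 * d) ≡ suc k + 2 * l + 2 + 2 * d
    e₃ = solve-∀
    e₄ : ∀ k l d → k + 2 + 2 * l + 2 * d ≡ suc k + 2 * l + 1 + 2 * d
    e₄ = solve-∀
    e₅ : ∀ k l d e → k + 2 + 2 * l + 2 * d + 1 + 2 * e ≡ k + 1 + 2 * (l + suc (d + e))
    e₅ = solve-∀
    e₆ : ∀ k l d e → k + 2 + 2 * l + 2 * d + 2 + 2 * e ≡ k + 2 + 2 * (l + suc (d + e))
    e₆ = solve-∀

  size-after : sizeF after ≡ sizeF before
  size-after = begin
    suc (sizeF L + sizeF (ds ++ node R ∷ ts))
      ≡⟨ cong (λ s → suc (sizeF L + s)) (sizeF-++ ds (node R ∷ ts)) ⟩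
    suc (sizeF L + (sizeF ds + suc (sizeF R + sizeF ts)))
      ≡⟨ regroup (sizeF L) (sizeF ds) (sizeF R) (sizeF ts) ⟩
    suc (sizeF L + suc (sizeF ds + sizeF R) + sizeF ts)
      ≡⟨ cong (λ s → suc (s + sizeF ts)) (sizeF-++ L (node ds ∷ R)) ⟨
    suc (sizeF cs + sizeF ts) ∎
    where
    open ≡-Reasoning
    regroup : ∀ l d e t → suc (l + (d + suc (e + t))) ≡ suc (l + suc (d + e) + t)
    regroup = solve-∀

  root-span-∈-before : (k , r) ∈ spans before k
  root-span-∈-before = root-span-∈ cs ts k

  child-span-∈-cs : (m , m') ∈ spans cs (suc k)
  child-span-∈-cs = subst ((m , m') ∈_) (sym spans-cs) (∈-++⁺ʳ A (root-span-∈ ds R m))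

  k<m : k < m
  k<m = m≤m+n (suc k) (2 * sizeF L)

  m<m' : m < m'
  m<m' = k<k+1+2s m (sizeF ds)

  m'<r : m' < r
  m'<r = subst (m' <_) (1+k+2s≡k+1+2s k (sizeF cs)) (proj₂ (proj₂ (spans-within cs (suc k) child-span-∈-cs)))

  parent : ∀ v c → ParentEdge before k v c k r m m'
  parent v c with edgesF-middle L ds R (suc k) (v ∷ʳ c) 0
  ... | f , f∈ , f-left , f-right , f-upper =
    _ , f , here refl , refl , refl , there (∈-++⁺ˡ f∈) , f-left , f-right , sym f-upper

  replaces : Replaces k m m' r (spans before k) (spans after k)
  replaces = subst₂ (Replaces k m m' r) (sym spans-before) (sym spans-after)
    (rotation-replaces k m m' r avoids-A avoids-B avoids-C avoids-D)
    where
    m<n : m < n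
    m<n = <-trans m<m' (<-trans m'<r (≤-reflexive (1+[k+1+2s]≡k+2+2s k (sizeF cs))))
    avoids-A : Avoids k m m' r A
    avoids-A x∈ with spans-within L (suc k) x∈
    ... | k<a , a<b , b<m = >⇒≢ k<a , <⇒≢ (<-trans a<b b<m)
    avoids-B : Avoids k m m' r B
    avoids-B x∈ with spans-within ds (suc m) x∈
    ... | m<a , _ = >⇒≢ (<-trans k<m m<a) , >⇒≢ m<a
    avoids-C : Avoids k m m' r C
    avoids-C x∈ with spans-within R (m + 2 + 2 * sizeF ds) x∈
    ... | next≤a , _ = >⇒≢ (<-trans k<m m<a) , >⇒≢ m<a
      where m<a = <-≤-trans (k<k+2+2s m (sizeF ds)) next≤a
    avoids-D : Avoids k m m' r D
    avoids-D x∈ with spans-within ts n x∈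
    ... | n≤a , _ = >⇒≢ (<-trans k<m m<a) , >⇒≢ m<a
      where m<a = <-≤-trans m<n n≤a

module GreedyRun (𝒜 : ComplementaryAlphabet) (P : List (ComplementaryAlphabet.Carrier 𝒜)) where
  open ComplementaryAlphabet 𝒜

  compl-partner : ∀ {i j a} → Compl 𝒜 P i j → letter 𝒜 P i ≡ just a → letter 𝒜 P j ≡ just (comp a)
  compl-partner (a' , b , pi , pj , b≡) pi′ =
    trans pj (cong just (trans b≡ (cong comp (just-injective (trans (sym pi) pi′)))))

  compl-across : ∀ {i j i' j'} → Compl 𝒜 P i j → Compl 𝒜 P i' j' → Compl 𝒜 P i i' → Compl 𝒜 P j' j
  compl-across (a , b , pi , pj , b≡) (a' , b' , pi' , pj' , b'≡) (a″ , b″ , pi″ , pi'″ , b″≡) =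
    b' , b , pj' , pj , (begin
      b       ≡⟨ b≡ ⟩
      comp a  ≡⟨ cong comp b'≡a ⟨
      comp b' ∎)
    where
    open ≡-Reasoning
    b'≡a : b' ≡ a
    b'≡a = begin
      b'               ≡⟨ b'≡ ⟩
      comp a'          ≡⟨ cong comp (just-injective (trans (sym pi') pi'″)) ⟩
      comp b″          ≡⟨ cong comp b″≡ ⟩
      comp (comp a″)   ≡⟨ comp-invol a″ ⟩
      a″               ≡⟨ just-injective (trans (sym pi″) pi) ⟩
      a                ∎

  record SuffixAt (k : ℕ) (as : List Carrier) : Set where
    constructor suffixAt
    field letter-at : ∀ n → letter 𝒜 P (k + n) ≡ letter 𝒜 as (suc n)
  open SuffixAt

  suffix-here : ∀ {k as} → SuffixAt k as → letter 𝒜 P k ≡ letter 𝒜 as 1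
  suffix-here {k} suf = trans (cong (letter 𝒜 P) (sym (+-identityʳ k))) (letter-at suf 0)

  suffix-tail : ∀ {k a as} → SuffixAt k (a ∷ as) → SuffixAt (suc k) as
  suffix-tail {k} suf = suffixAt λ n → trans (cong (letter 𝒜 P) (sym (+-suc k n))) (letter-at suf (suc n))

  letter-beyond : ∀ (Q : List Carrier) n → length Q ≤ n → letter 𝒜 Q (suc n) ≡ nothing
  letter-beyond []      n       _          = refl
  letter-beyond (a ∷ Q) (suc n) (s≤s len≤) = letter-beyond Q n len≤

  Stack : Set
  Stack = List (ℕ × Carrier)

  TopComplements : Stack → Carrier → Set
  TopComplements st a = ∃[ j ] ∃[ b ] ∃[ st' ] (st ≡ (j , b) ∷ st' × a ≡ comp b)

  greedyGo-match : ∀ {a as i j b st} → a ≡ comp b →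
    greedyGo 𝒜 (a ∷ as) i ((j , b) ∷ st) ≡ (j , i) ∷ greedyGo 𝒜 as (suc i) st
  greedyGo-match {a} {b = b} a≡ with a ≟ comp b
  ... | yes _  = refl
  ... | no a≢ = ⊥-elim (a≢ a≡)

  greedyGo-match-or-push : ∀ a as k st →
    TopComplements st a ⊎ greedyGo 𝒜 (a ∷ as) k st ≡ greedyGo 𝒜 as (suc k) ((k , a) ∷ st)
  greedyGo-match-or-push a as k []            = inj₂ refl
  greedyGo-match-or-push a as k ((j , b) ∷ st) with a ≟ comp b
  ... | yes a≡ = inj₁ (j , b , st , refl , a≡)
  ... | no _   = inj₂ refl

  greedyGo-close : ∀ {r k a st as} → SuffixAt r as → letter 𝒜 P r ≡ just (comp a) →
    ∃[ as' ] (SuffixAt (suc r) as' × greedyGo 𝒜 as r ((k , a) ∷ st) ≡ (k , r) ∷ greedyGo 𝒜 as' (suc r) st)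
  greedyGo-close {as = []}     suf pr with trans (sym pr) (suffix-here suf)
  ... | ()
  greedyGo-close {as = y ∷ as} suf pr =
    as , suffix-tail suf , greedyGo-match (just-injective (trans (sym (suffix-here suf)) pr))

  greedyGo-node : ∀ cs ts {a as as₁ as₂ k st G} →
    greedyGo 𝒜 (a ∷ as) k st ≡ greedyGo 𝒜 as (suc k) ((k , a) ∷ st) →
    greedyGo 𝒜 as (suc k) ((k , a) ∷ st)
      ≡ spans cs (suc k) ++ greedyGo 𝒜 as₁ (suc k + 2 * sizeF cs) ((k , a) ∷ st) →
    greedyGo 𝒜 as₁ (suc k + 2 * sizeF cs) ((k , a) ∷ st)
      ≡ (k , suc k + 2 * sizeF cs) ∷ greedyGo 𝒜 as₂ (suc (suc k + 2 * sizeF cs)) st →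
    greedyGo 𝒜 as₂ (k + 2 + 2 * sizeF cs) st ≡ spans ts (k + 2 + 2 * sizeF cs) ++ G →
    greedyGo 𝒜 (a ∷ as) k st ≡ spans (node cs ∷ ts) k ++ G
  greedyGo-node cs ts {a} {as} {as₁} {as₂} {k} {st} {G} push greedy-cs greedy-close greedy-ts = begin
    greedyGo 𝒜 (a ∷ as) k st                                   ≡⟨ push ⟩
    greedyGo 𝒜 as (suc k) ((k , a) ∷ st)                       ≡⟨ greedy-cs ⟩
    spans cs (suc k) ++ greedyGo 𝒜 as₁ r′ ((k , a) ∷ st)       ≡⟨ cong (spans cs (suc k) ++_) greedy-close ⟩
    spans cs (suc k) ++ (k , r′) ∷ greedyGo 𝒜 as₂ (suc r′) st
      ≡⟨ cong₂ (λ r z → spans cs (suc k) ++ (k , r) ∷ z) (1+k+2s≡k+1+2s k (sizeF cs))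
               (trans (cong (λ z → greedyGo 𝒜 as₂ z st) (2+k+2s≡k+2+2s k (sizeF cs))) greedy-ts) ⟩
    spans cs (suc k) ++ (k , r) ∷ (spans ts n ++ G)            ≡⟨ ++-assoc (spans cs (suc k)) ((k , r) ∷ spans ts n) G ⟨
    spans (node cs ∷ ts) k ++ G                                ∎
    where
    open ≡-Reasoning
    r′ = suc k + 2 * sizeF cs
    r  = k + 1 + 2 * sizeF cs
    n  = k + 2 + 2 * sizeF cs

  ValidSpans : List PlaneTree → ℕ → Set
  ValidSpans ts k = ∀ {x} → x ∈ spans ts k → Compl 𝒜 P (proj₁ x) (proj₂ x)

  record Move (ts : List PlaneTree) (k : ℕ) (v : Vertex) (c : ℕ) : Set where
    field
      i j i' j'   : ℕ
      i<j         : i < j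
      j<i'        : j < i'
      i'<j'       : i' < j'
      k≤i         : k ≤ i
      j'<end      : j' < k + 2 * sizeF ts
      parent      : ParentEdge ts k v c i j' j i'
      compl-ij    : Compl 𝒜 P i j
      compl-i'j'  : Compl 𝒜 P i' j'
      result      : List PlaneTree
      result-size : sizeF result ≡ sizeF ts
      replaces    : Replaces i j i' j' (spans ts k) (spans result k)

  move-in-children : ∀ cs ts k v c → Move cs (suc k) (v ∷ʳ c) 0 → Move (node cs ∷ ts) k v c
  move-in-children cs ts k v c mv = record
    { i = i ; j = j ; i' = i' ; j' = j' ; i<j = i<j ; j<i' = j<i' ; i'<j' = i'<j'
    ; k≤i         = <⇒≤ k≤i
    ; j'<end      = <-≤-trans j'<end (1+k+2s≤k+2[1+s+t] k (sizeF cs) (sizeF ts))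
    ; parent      = ParentEdge-children cs ts k v c parent
    ; compl-ij    = compl-ij
    ; compl-i'j'  = compl-i'j'
    ; result      = node cs' ∷ ts
    ; result-size = cong (λ s → suc (s + sizeF ts)) result-size
    ; replaces    = replaces′
    }
    where
    open Move mv renaming (result to cs')
    avoids : Avoids i j i' j' ((k , k + 1 + 2 * sizeF cs) ∷ spans ts (k + 2 + 2 * sizeF cs))
    avoids (here refl)   = <⇒≢ k≤i , <⇒≢ (<-trans k≤i i<j)
    avoids (there x∈ts) = >⇒≢ (<-trans i<j j<a) , >⇒≢ j<a
      where
      next≤a = proj₁ (spans-within ts _ x∈ts)
      j<a = <-trans j<i' (<-trans i'<j' (<-trans j'<end (<-≤-trans (1+k+2s<k+2+2s k (sizeF cs)) next≤a)))
    replaces′ : Replaces i j i' j'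
      (spans cs (suc k) ++ (k , k + 1 + 2 * sizeF cs) ∷ spans ts (k + 2 + 2 * sizeF cs))
      (spans cs' (suc k) ++ (k , k + 1 + 2 * sizeF cs') ∷ spans ts (k + 2 + 2 * sizeF cs'))
    replaces′ rewrite result-size = Replaces-++ʳ i j i' j' replaces avoids

  move-in-siblings : ∀ cs ts k v c → Move ts (k + 2 + 2 * sizeF cs) v (suc c) → Move (node cs ∷ ts) k v c
  move-in-siblings cs ts k v c mv = record
    { i = i ; j = j ; i' = i' ; j' = j' ; i<j = i<j ; j<i' = j<i' ; i'<j' = i'<j'
    ; k≤i         = ≤-trans (<⇒≤ (k<k+2+2s k (sizeF cs))) k≤i
    ; j'<end      = subst (j' <_) (k+2+2s+2t≡k+2[1+s+t] k (sizeF cs) (sizeF ts)) j'<end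
    ; parent      = ParentEdge-siblings cs ts k v c parent
    ; compl-ij    = compl-ij
    ; compl-i'j'  = compl-i'j'
    ; result      = node cs ∷ ts'
    ; result-size = cong (λ s → suc (sizeF cs + s)) result-size
    ; replaces    = Replaces-++ˡ i j i' j' (Replaces-++ˡ i j i' j' replaces avoids-root) avoids-cs
    }
    where
    open Move mv renaming (result to ts')
    avoids-below : ∀ {a} → a < i → a ≢ i × a ≢ j
    avoids-below a<i = <⇒≢ a<i , <⇒≢ (<-trans a<i i<j)
    avoids-root : Avoids i j i' j' ((k , k + 1 + 2 * sizeF cs) ∷ [])
    avoids-root (here refl) = avoids-below (<-≤-trans (k<k+2+2s k (sizeF cs)) k≤i)
    avoids-cs : Avoids i j i' j' (spans cs (suc k))
    avoids-cs x∈ with spans-within cs (suc k) x∈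
    ... | _ , a<b , b<end = avoids-below (<-≤-trans (<-trans a<b (<-trans b<end (1+k+2s<k+2+2s k (sizeF cs)))) k≤i)

  rotation-move : ∀ L ds R ts k v c {a} → letter 𝒜 P k ≡ just a →
    letter 𝒜 P (suc k + 2 * sizeF L) ≡ just (comp a) →
    ValidSpans (node (L ++ node ds ∷ R) ∷ ts) k → Move (node (L ++ node ds ∷ R) ∷ ts) k v c
  rotation-move L ds R ts k v c {a} pk pm valid = record
    { i = k ; j = m ; i' = m' ; j' = r ; i<j = k<m ; j<i' = m<m' ; i'<j' = m'<r
    ; k≤i         = ≤-refl
    ; j'<end      = k+1+2s<k+2[1+s+t] k (sizeF cs) (sizeF ts)
    ; parent      = parent v c
    ; compl-ij    = compl-km
    ; compl-i'j'  = compl-across (valid root-span-∈-before) (valid (∈-++⁺ˡ child-span-∈-cs)) compl-km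
    ; result      = after
    ; result-size = size-after
    ; replaces    = replaces
    }
    where
    open Rotation L ds R ts k
    compl-km : Compl 𝒜 P k m
    compl-km = a , comp a , pk , pm , refl

  -- In top-match the greedy algorithm matches the stack top with the left label
  -- of a root edge of ts; one level up this is a rotation with the parent edge.
  data Outcome (ts : List PlaneTree) (k : ℕ) (v : Vertex) (c : ℕ) (st : Stack) (as : List Carrier) : Set where
    move      : Move ts k v c → Outcome ts k v c st as
    top-match : ∀ {j b st'} L ds R → st ≡ (j , b) ∷ st' → ts ≡ L ++ node ds ∷ R →
                letter 𝒜 P (k + 2 * sizeF L) ≡ just (comp b) → Outcome ts k v c st as
    traverses : ∀ k' as' → k' ≡ k + 2 * sizeF ts → SuffixAt k' as' →
                greedyGo 𝒜 as k st ≡ spans ts k ++ greedyGo 𝒜 as' k' st → Outcome ts k v c st as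

  run : ∀ ts k v c st as → SuffixAt k as → ValidSpans ts k → Outcome ts k v c st as
  run [] k v c st as suf _ = traverses k as (sym (+-identityʳ k)) suf refl
  run (node cs ∷ ts) k v c st [] suf valid with valid (root-span-∈ cs ts k)
  ... | _ , _ , pk , _ with trans (sym pk) (suffix-here suf)
  ...   | ()
  run (node cs ∷ ts) k v c st (a ∷ as) suf valid with greedyGo-match-or-push a as k st
  ... | inj₁ (_ , _ , _ , st≡ , a≡) = top-match [] cs ts st≡ refl (trans (letter-at suf 0) (cong just a≡))
  ... | inj₂ push with run cs (suc k) (v ∷ʳ c) 0 ((k , a) ∷ st) as (suffix-tail suf) (λ x∈ → valid (∈-++⁺ˡ x∈))
  ...   | move mv = move (move-in-children cs ts k v c mv)
  ...   | top-match L ds R refl refl pm = move (rotation-move L ds R ts k v c (suffix-here suf) pm valid)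
  ...   | traverses _ as₁ refl suf₁ greedy-cs with greedyGo-close {k = k} {st = st} suf₁ pr
    where
    pr : letter 𝒜 P (suc k + 2 * sizeF cs) ≡ just (comp a)
    pr = subst (λ z → letter 𝒜 P z ≡ just (comp a)) (sym (1+k+2s≡k+1+2s k (sizeF cs)))
           (compl-partner (valid (root-span-∈ cs ts k)) (suffix-here suf))
  ...   | as₂ , suf₂ , greedy-close
          with run ts (k + 2 + 2 * sizeF cs) v (suc c) st as₂
                   (subst (λ z → SuffixAt z as₂) (2+k+2s≡k+2+2s k (sizeF cs)) suf₂)
                   (λ x∈ → valid (∈-++⁺ʳ (spans cs (suc k)) (there x∈)))
  ...     | move mv = move (move-in-siblings cs ts k v c mv)
  ...     | top-match {b = b} L ds R st≡ refl pl =
    top-match (node cs ∷ L) ds R st≡ refl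
      (subst (λ z → letter 𝒜 P z ≡ just (comp b)) (k+2+2s+2t≡k+2[1+s+t] k (sizeF cs) (sizeF L)) pl)
  ...     | traverses k' as₃ k'≡ suf₃ greedy-ts =
    traverses k' as₃ (trans k'≡ (k+2+2s+2t≡k+2[1+s+t] k (sizeF cs) (sizeF ts))) suf₃
      (greedyGo-node cs ts {a} {as} {as₁} {as₂} {k} {st} push greedy-cs greedy-close greedy-ts)

  valid-spans : ∀ {cs} → Valid 𝒜 P (node cs) → ValidSpans cs 1
  valid-spans {cs} (_ , compl) {a , b} ab∈ = compl a b (∈-spans⇒isEdge cs ab∈)

  suffix-beyond-end : ∀ {cs y ys} → Valid 𝒜 P (node cs) → ¬ SuffixAt (1 + 2 * sizeF cs) (y ∷ ys)
  suffix-beyond-end {cs} (size≡ , _) suf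
    with trans (sym (suffix-here suf)) (letter-beyond P (2 * sizeF cs) (≤-reflexive (sym size≡)))
  ... | ()

  greedy-tree-unique : ∀ {cs₀ cs} → IsGreedyTree 𝒜 P (node cs₀) → greedy 𝒜 P ≡ spans cs 1 → cs ≡ cs₀
  greedy-tree-unique {cs₀} {cs} (_ , greedy-edges) greedy≡ = spans-injective cs cs₀ 1 ⊆₀ ⊇₀
    where
    ⊆₀ : spans cs 1 ⊆ spans cs₀ 1
    ⊆₀ {a , b} ab∈ = isEdge⇒∈-spans cs₀ (proj₂ (greedy-edges a b) (subst ((a , b) ∈_) (sym greedy≡) ab∈))
    ⊇₀ : spans cs₀ 1 ⊆ spans cs 1
    ⊇₀ {a , b} ab∈ = subst ((a , b) ∈_) greedy≡ (proj₁ (greedy-edges a b) (∈-spans⇒isEdge cs₀ ab∈))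

  replaceResult-valid : ∀ {T T' i j i' j'} → ReplaceResult 𝒜 T i j i' j' T' → Valid 𝒜 P T →
    Compl 𝒜 P i j → Compl 𝒜 P i' j' → Valid 𝒜 P T'
  replaceResult-valid {T' = T'} (size≡ , edges≡) (sizeT , compl) compl-ij compl-i'j' =
    trans (cong (2 *_) size≡) sizeT , compl′
    where
    compl′ : ∀ a b → IsEdge T' a b → Compl 𝒜 P a b
    compl′ a b ab with proj₁ (edges≡ a b) ab
    ... | inj₁ (ab∈T , _)  = compl a b ab∈T
    ... | inj₂ (inj₁ refl) = compl-ij
    ... | inj₂ (inj₂ refl) = compl-i'j'

  replaces⇒replaceResult : ∀ {cs cs' i j i' j'} → sizeF cs' ≡ sizeF cs →
    Replaces i j i' j' (spans cs 1) (spans cs' 1) → ReplaceResult 𝒜 (node cs) i j i' j' (node cs')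
  replaces⇒replaceResult {cs} {cs'} size≡ replaces = size≡ , λ a b → to a b , from a b
    where
    to : ∀ a b → IsEdge (node cs') a b → _
    to a b ab with proj₁ (replaces (a , b)) (isEdge⇒∈-spans cs' ab)
    ... | inj₁ (ab∈ , ≢₁ , ≢₂) = inj₁ (∈-spans⇒isEdge cs ab∈ , ≢₁ , ≢₂)
    ... | inj₂ new             = inj₂ new
    from : ∀ a b → _ → IsEdge (node cs') a b
    from a b (inj₁ (ab , ≢₁ , ≢₂)) = ∈-spans⇒isEdge cs' (proj₂ (replaces (a , b)) (inj₁ (isEdge⇒∈-spans cs ab , ≢₁ , ≢₂)))
    from a b (inj₂ new)            = ∈-spans⇒isEdge cs' (proj₂ (replaces (a , b)) (inj₂ new))

  move⇒type2 : ∀ {cs} → Valid 𝒜 P (node cs) → Move cs 1 [] 0 → HasValidType2Move 𝒜 P (node cs)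
  move⇒type2 {cs} valid mv =
    i , j , i' , j' , i<j , j<i' , i'<j' , share , node result , replace-result ,
    replaceResult-valid replace-result valid compl-ij compl-i'j'
    where
    open Move mv
    replace-result = replaces⇒replaceResult result-size replaces
    share : EdgesShareVertex (node cs) i j' j i'
    share with parent
    ... | e , f , e∈ , e-left , e-right , f∈ , f-left , f-right , e-f =
      e , f , e∈ , e-left , e-right , f∈ , f-left , f-right , inj₂ (inj₂ (inj₁ e-f))

open GreedyRun

mainTheorem4 : (𝒜 : ComplementaryAlphabet) (P : List (ComplementaryAlphabet.Carrier 𝒜))
    → ∃[ S ] Valid 𝒜 P S
    → (T₀ : PlaneTree) → IsGreedyTree 𝒜 P T₀
    → (T : PlaneTree) → Valid 𝒜 P T → T ≢ T₀
    → HasValidType2Move 𝒜 P T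
mainTheorem4 𝒜 P _ (node cs₀) greedy-T₀ (node cs) valid-T T≢T₀
  with run 𝒜 P cs 1 [] 0 [] P (suffixAt λ _ → refl) (valid-spans 𝒜 P valid-T)
... | move mv = move⇒type2 𝒜 P valid-T mv
... | top-match _ _ _ () _ _
... | traverses _ [] _ _ greedy≡ =
  ⊥-elim (T≢T₀ (cong node (greedy-tree-unique 𝒜 P greedy-T₀ (trans greedy≡ (++-identityʳ (spans cs 1))))))
... | traverses _ (_ ∷ _) refl suf _ = ⊥-elim (suffix-beyond-end 𝒜 P valid-T suf)
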